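{- Let $d$ be a positive integer, let $H=(V,E)$ be a $d$-sparse graph, let $\mathcal{X}$ be its $d$-critical cover, and let $W\in\Theta_k(\mathcal{X})$ for some $0\le k\le d-1$. Suppose that each $d$-critical component of $H$ whose vertex set contains $W$ has at least $d+2$ vertices. Then $$(d-k)\sum_{\substack{U\in\Theta_{k+1}(\mathcal{X})\\ W\subset U}}(d_{\mathcal{X}}(U)-1)\;-\;\sum_{\substack{U\in\Theta_{k+2}(\mathcal{X})\\ W\subset U}}(d_{\mathcal{X}}(U)-1)\;<\;\binom{d+1-k}{2}\,(d_{\mathcal{X}}(W)-1).$$
   Context: For $X\subseteq V$, $i_H(X)$ is the number of edges of $H$ with both ends in $X$. $H$ is $d$-sparse if $i_H(X)\le d|X|-\binom{d+1}{2}$ for all $X\subseteq V$ with $|X|\ge d$. A subgraph $(U,F)$ of $H$ is $d$-critical if either $|U|=2$ and $|F|=1$, or $|U|\ge d+2$ and $|F|=d|U|-\binom{d+1}{2}$; a $d$-critical component is a $d$-critical subgraph not properly contained in another one. The $d$-critical cover $\mathcal{X}$ of $H$ is the family of vertex sets of the $d$-critical components of $H$. A $k$-hinge of $\mathcal{X}$ is a set of $k$ vertices contained in the intersection of at least two sets of $\mathcal{X}$; $\Theta_k(\mathcal{X})$ is the set of all $k$-hinges, with the convention $\Theta_0(\mathcal{X})=\{\emptyset\}$. For a hinge $U$, $d_{\mathcal{X}}(U)$ is the number of sets of $\mathcal{X}$ containing $U$ (so $d_{\mathcal{X}}(\emptyset)=|\mathcal{X}|$). $W\subset U$ denotes proper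 inclusion. -}

module Defs where

open import Data.Bool using (Bool; true; false; _∧_; if_then_else_)
open import Data.Nat as ℕ using (ℕ; zero; suc; _≤_; _<ᵇ_)
open import Data.Nat.Combinatorics using (_C_)
open import Data.Fin using (Fin; toℕ)
open import Data.Fin.Properties using (any?)
open import Data.Fin.Subset using (Subset; inside; outside; _⊆_; _⊂_; ∣_∣)
open import Data.Fin.Subset.Properties using (_⊆?_; _∈?_)
open import Data.Integer as ℤ using (ℤ; +_)
open import Data.List as List using (List; []; _∷_; _++_; map; filter; length; foldr)
open import Data.List.Membership.Propositional as Mem using ()
open import Data.List.Relation.Unary.Unique.Propositional using (Unique)
open import Data.Vec using (lookup)
open import Data.Nat.ListAction using () renaming (sum to sumℕ)
open import Data.Vec.Functional using ()
open import Data.Product using (Σ; _×_; _,_; ∃)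
open import Data.Sum using (_⊎_)
open import Function.Bundles using (_⇔_)
open import Relation.Binary.PropositionalEquality using (_≡_)
open import Relation.Nullary using (¬_; Dec)
open import Relation.Nullary.Decidable using (_×-dec_; ¬?)

record Graph (n : ℕ) : Set where
  field
    adj    : Fin n → Fin n → Bool
    sym    : ∀ i j → adj i j ≡ adj j i
    irrefl : ∀ i → adj i i ≡ false
open Graph public

pairCount : {n : ℕ} → (Fin n → Fin n → Bool) → ℕ
pairCount {n} R =
  sumℕ (map (λ i → sumℕ (map (λ j →
     if (toℕ i <ᵇ toℕ j) ∧ R i j then 1 else 0) (List.allFin n))) (List.allFin n))

iH : {n : ℕ} → Graph n → Subset n → ℕ
iH H X = pairCount (λ i j → adj H i j ∧ (lookup X i ∧ lookup X j))

Sparse : {n : ℕ} → ℕ → Graph n → Set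
Sparse d H = ∀ X → d ≤ ∣ X ∣ → iH H X ≤ d ℕ.* ∣ X ∣ ℕ.∸ (suc d C 2)

record Subgraph {n : ℕ} (H : Graph n) : Set where
  field
    U      : Subset n
    F      : Fin n → Fin n → Bool
    F-sym  : ∀ i j → F i j ≡ F j i
    F⊆E    : ∀ i j → F i j ≡ true → adj H i j ≡ true
    F-ends : ∀ i j → F i j ≡ true → lookup U i ≡ true
open Subgraph public

edgeCount : {n : ℕ} {H : Graph n} → Subgraph H → ℕ
edgeCount S = pairCount (F S)

_≤S_ : {n : ℕ} {H : Graph n} → Subgraph H → Subgraph H → Set
S ≤S T = (U S ⊆ U T) × (∀ i j → F S i j ≡ true → F T i j ≡ true)

_<S_ : {n : ℕ} {H : Graph n} → Subgraph H → Subgraph H → Set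
S <S T = (S ≤S T) × ¬ ((U S ≡ U T) × (∀ i j → F S i j ≡ F T i j))

Critical : {n : ℕ} {H : Graph n} → ℕ → Subgraph H → Set
Critical d S =
    ((∣ U S ∣ ≡ 2) × (edgeCount S ≡ 1))
  ⊎ ((suc (suc d) ≤ ∣ U S ∣) × (edgeCount S ≡ d ℕ.* ∣ U S ∣ ℕ.∸ (suc d C 2)))

Component : {n : ℕ} {H : Graph n} → ℕ → Subgraph H → Set
Component {H = H} d S = Critical d S × (∀ (T : Subgraph H) → Critical d T → ¬ (S <S T))

CoverSet : {n : ℕ} → ℕ → Graph n → Subset n → Set
CoverSet d H X = Σ (Subgraph H) (λ S → Component d S × (U S ≡ X))

IsCriticalCover : {n : ℕ} → ℕ → Graph n → List (Subset n) → Set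
IsCriticalCover d H Xs = Unique Xs × (∀ X → (X Mem.∈ Xs) ⇔ CoverSet d H X)

deg : {n : ℕ} → List (Subset n) → Subset n → ℕ
deg Xs W = length (filter (W ⊆?_) Xs)

Hinge : {n : ℕ} → List (Subset n) → ℕ → Subset n → Set
Hinge Xs k W = (∣ W ∣ ≡ k) × (2 ≤ deg Xs W)

hinge? : {n : ℕ} (Xs : List (Subset n)) (k : ℕ) (W : Subset n) → Dec (Hinge Xs k W)
hinge? Xs k W = (∣ W ∣ ℕ.≟ k) ×-dec (2 ℕ.≤? deg Xs W)

_⊂?_ : {n : ℕ} (W U : Subset n) → Dec (W ⊂ U)
W ⊂? U = (W ⊆? U) ×-dec any? (λ x → (x ∈? U) ×-dec ¬? (x ∈? W))

allSubsets : (n : ℕ) → List (Subset n)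
allSubsets zero    = Data.Vec.[] ∷ []
allSubsets (suc n) = map (inside Data.Vec.∷_) (allSubsets n) ++ map (outside Data.Vec.∷_) (allSubsets n)

sumℤ : List ℤ → ℤ
sumℤ = foldr ℤ._+_ (+ 0)

hingeSum : {n : ℕ} → List (Subset n) → ℕ → Subset n → ℤ
hingeSum {n} Xs j W =
  sumℤ (map (λ U → (+ deg Xs U) ℤ.- (+ 1))
            (filter (λ U → hinge? Xs j U ×-dec (W ⊂? U)) (allSubsets n)))

module Submission where

-- Let X₁, …, Xₘ (m = d(W) ≥ 2) be the d-critical components containing W, and Y
-- their union. Every Xₜ is tight, i(Xₜ) + C(d+1,2) = d|Xₜ|, whereas Y is not:
-- i(Y) + C(d+1,2) < d|Y|, since otherwise Y would span a critical subgraph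
-- containing two distinct components. A vertex v ∉ W lying in c ≥ 2 of the Xₜ is
-- a (k+1)-hinge W ∪ {v} of degree c, and likewise for pairs, so counting every
-- vertex and edge with its multiplicity gives
--   Σₜ |Xₜ|  = |Y| + k(m−1) + Σ₁,
--   Σₜ i(Xₜ) ≤ i(Y) + C(k,2)(m−1) + kΣ₁ + Σ₂,
-- where Σ₁, Σ₂ are the two hinge sums. Adding up the tight equations and using
-- the slack of Y leaves (d−k)Σ₁ − Σ₂ < (C(k,2) + C(d+1,2) − dk)(m−1), and
-- C(k,2) + C(d+1,2) − dk = C(d+1−k,2).

open import Defs renaming (sym to adj-sym)

open import Data.Bool as Bool using (Bool; true; false; _∧_; not; if_then_else_)
open import Data.Bool.Properties using (∧-comm; ∧-identityʳ; ∧-zeroʳ; ∧-conicalˡ; ∧-conicalʳ)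
open import Data.Fin using (Fin; toℕ) renaming (zero to fzero; suc to fsuc)
open import Data.Fin.Subset using (Subset; inside; outside; _∈_; _∉_; _⊆_; _⊂_; ∣_∣)
open import Data.Fin.Subset.Properties
  using (_⊆?_; p⊆q⇒∣p∣≤∣q∣; drop-there; drop-∷-⊆; ⊆-refl; ⊆-trans)
open import Data.Integer as ℤ using (ℤ)
import Data.Integer.Properties as ℤ
open import Data.List as List using (List; []; _∷_; _++_; map; filter; length)
open import Data.List.Membership.Propositional using () renaming (_∈_ to _∈ₗ_)
open import Data.List.Membership.Propositional.Properties using (∈-filter⁻; ∈-lookup)
open import Data.List.Properties using (filter-reject)
open import Data.List.Relation.Unary.All using (_∷_)
open import Data.List.Relation.Unary.AllPairs using (_∷_)
open import Data.List.Relation.Unary.Unique.Propositional using (Unique)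
import Data.List.Relation.Unary.Unique.Propositional.Properties as Unique
open import Data.Nat using (ℕ; zero; suc; _≤_; _<_; _+_; _*_; _∸_; z≤n; s≤s; _<ᵇ_; _≟_)
open import Data.Nat.Combinatorics using (_C_; nC1≡n; nCk+nC[k+1]≡[n+1]C[k+1])
open import Data.Nat.ListAction using () renaming (sum to sumℕ)
open import Data.Nat.Properties
open import Algebra.Properties.Semiring.Sum +-*-semiring
  using (sum; sum-syntax; sum-cong-≗; sum-replicate-zero; ∑-distrib-+; ∑-comm; *-distribˡ-sum)
open import Data.Nat.Tactic.RingSolver using (solve-∀)
open import Data.Product using (_×_; _,_; proj₁; proj₂; ∃; ∃₂)
open import Data.Sum using (inj₁; inj₂)
open import Data.Vec using ([]; _∷_; lookup; tabulate; _[_]≔_; here; there)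
open import Data.Vec.Properties using (lookup∘tabulate; []=⇒lookup; lookup⇒[]=; ≡-dec)
open import Function using (_∘_)
open import Function.Bundles using (Equivalence)
open import Relation.Binary.PropositionalEquality
open import Relation.Nullary using (Dec; does; yes; no)
open import Relation.Nullary.Decidable using (_×-dec_; dec-true; dec-false; decidable-stable)
open import Relation.Nullary.Negation using (contradiction)
open import Relation.Unary using (Pred; Decidable)

-- Binomial coefficients

C2-suc : ∀ n → n + (n C 2) ≡ suc n C 2
C2-suc n = trans (cong (_+ (n C 2)) (sym (nC1≡n n))) (nCk+nC[k+1]≡[n+1]C[k+1] n 1)

double-C2 : ∀ n → 2 * (n C 2) + n ≡ n * n
double-C2 zero    = refl
double-C2 (suc n) = begin
  2 * (suc n C 2) + suc n        ≡⟨ cong (λ c → 2 * c + suc n) (C2-suc n) ⟨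
  2 * (n + (n C 2)) + suc n      ≡⟨ regroup n (n C 2) ⟩
  (2 * (n C 2) + n) + suc (2 * n) ≡⟨ cong (_+ suc (2 * n)) (double-C2 n) ⟩
  n * n + suc (2 * n)            ≡⟨ square n ⟩
  suc n * suc n                  ∎
  where
  open ≡-Reasoning
  regroup : ∀ n c → 2 * (n + c) + suc n ≡ (2 * c + n) + suc (2 * n)
  regroup = solve-∀
  square : ∀ n → n * n + suc (2 * n) ≡ suc n * suc n
  square = solve-∀

C2≤ : ∀ d {x} → suc d ≤ x → suc d C 2 ≤ d * x
C2≤ d {x} d<x = begin
  suc d C 2           ≤⟨ m≤m+n (suc d C 2) (suc d C 2 + 0) ⟩
  2 * (suc d C 2)     ≡⟨ +-cancelʳ-≡ (suc d) _ _ twice ⟩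
  suc d * d           ≡⟨ *-comm (suc d) d ⟩
  d * suc d           ≤⟨ *-monoʳ-≤ d d<x ⟩
  d * x               ∎
  where
  open ≤-Reasoning
  twice : 2 * (suc d C 2) + suc d ≡ suc d * d + suc d
  twice = trans (double-C2 (suc d)) (trans (*-suc (suc d) d) (+-comm (suc d) (suc d * d)))

C2-+ : ∀ k e → (k C 2) + (suc (k + e) C 2) ≡ (k + e) * k + (suc e C 2)
C2-+ k e = *-cancelˡ-≡ _ _ 2 (+-cancelʳ-≡ (suc (k + e) + k) _ _ (begin
  2 * ((k C 2) + (suc (k + e) C 2)) + (suc (k + e) + k)
    ≡⟨ lhs-shape k e (k C 2) (suc (k + e) C 2) ⟩
  (2 * (k C 2) + k) + (2 * (suc (k + e) C 2) + suc (k + e))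
    ≡⟨ cong₂ _+_ (double-C2 k) (double-C2 (suc (k + e))) ⟩
  k * k + suc (k + e) * suc (k + e)
    ≡⟨ squares k e ⟩
  2 * ((k + e) * k) + suc e * suc e + 2 * k
    ≡⟨ cong (λ x → 2 * ((k + e) * k) + x + 2 * k) (double-C2 (suc e)) ⟨
  2 * ((k + e) * k) + (2 * (suc e C 2) + suc e) + 2 * k
    ≡⟨ rhs-shape k e (suc e C 2) ⟨
  2 * ((k + e) * k + (suc e C 2)) + (suc (k + e) + k) ∎))
  where
  open ≡-Reasoning
  lhs-shape : ∀ k e a b → 2 * (a + b) + (suc (k + e) + k) ≡ (2 * a + k) + (2 * b + suc (k + e))
  lhs-shape = solve-∀
  squares : ∀ k e → k * k + suc (k + e) * suc (k + e) ≡ 2 * ((k + e) * k) + suc e * suc e + 2 * k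
  squares = solve-∀
  rhs-shape : ∀ k e c → 2 * ((k + e) * k + c) + (suc (k + e) + k) ≡ 2 * ((k + e) * k) + (2 * c + suc e) + 2 * k
  rhs-shape = solve-∀

C2-split : ∀ {k d} → k ≤ d → (k C 2) + (suc d C 2) ≡ d * k + ((suc d ∸ k) C 2)
C2-split {k} k≤d with e , refl ← m≤n⇒∃[o]m+o≡n k≤d =
  trans (C2-+ k e) (cong (λ x → (k + e) * k + (x C 2)) (sym suc[k+e]∸k))
  where
  suc[k+e]∸k : suc (k + e) ∸ k ≡ suc e
  suc[k+e]∸k = trans (+-∸-assoc 1 (m≤m+n k e)) (cong suc (m+n∸m≡n k e))

-- Finite sums

infixr 7 _·ᵇ_

_·ᵇ_ : Bool → ℕ → ℕ
b ·ᵇ x = if b then x else 0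

𝟙 : Bool → ℕ
𝟙 b = b ·ᵇ 1

·ᵇ-∧ : ∀ a b x → (a ∧ b) ·ᵇ x ≡ a ·ᵇ b ·ᵇ x
·ᵇ-∧ true  b x = refl
·ᵇ-∧ false b x = refl

𝟙≤𝟙 : ∀ {a b} → (a ≡ true → b ≡ true) → 𝟙 a ≤ 𝟙 b
𝟙≤𝟙 {false} a⇒b = z≤n
𝟙≤𝟙 {true}  a⇒b rewrite a⇒b refl = ≤-refl

m≡𝟙[0<m]+[m∸1] : ∀ m → m ≡ 𝟙 (0 <ᵇ m) + (m ∸ 1)
m≡𝟙[0<m]+[m∸1] zero    = refl
m≡𝟙[0<m]+[m∸1] (suc m) = refl

m≤𝟙+[m∸1] : ∀ m {b} → (1 ≤ m → b ≡ true) → m ≤ 𝟙 b + (m ∸ 1)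
m≤𝟙+[m∸1] zero    b-holds = z≤n
m≤𝟙+[m∸1] (suc m) b-holds rewrite b-holds (s≤s z≤n) = ≤-refl

∑-mono-≤ : ∀ {n} {f g : Fin n → ℕ} → (∀ i → f i ≤ g i) → sum f ≤ sum g
∑-mono-≤ {zero}  f≤g = z≤n
∑-mono-≤ {suc n} f≤g = +-mono-≤ (f≤g fzero) (∑-mono-≤ (f≤g ∘ fsuc))

term≤∑ : ∀ {n} (f : Fin n → ℕ) i → f i ≤ sum f
term≤∑ f fzero    = m≤m+n _ _
term≤∑ f (fsuc i) = ≤-trans (term≤∑ (f ∘ fsuc) i) (m≤n+m _ (f fzero))

∑-const : ∀ n x → ∑[ i < n ] x ≡ n * x
∑-const zero    x = refl
∑-const (suc n) x = cong (x +_) (∑-const n x)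

·ᵇ-distrib-∑ : ∀ {n} b (f : Fin n → ℕ) → b ·ᵇ sum f ≡ ∑[ i < n ] (b ·ᵇ f i)
·ᵇ-distrib-∑ true  f = refl
·ᵇ-distrib-∑ {n} false f = sym (sum-replicate-zero n)

sum-tabulate : ∀ {A : Set} {n} (f : A → ℕ) (g : Fin n → A) →
               sumℕ (map f (List.tabulate g)) ≡ ∑[ i < n ] (f (g i))
sum-tabulate {n = zero}  f g = refl
sum-tabulate {n = suc n} f g = cong (f (g fzero) +_) (sum-tabulate f (g ∘ fsuc))

_<ᶠ_ : ∀ {n} → Fin n → Fin n → Bool
i <ᶠ j = toℕ i <ᵇ toℕ j

-- Over Fin (suc n) this unfolds definitionally into the pairs (0, j+1) and the
-- pairs (i+1, j+1) with i < j.
∑< : ∀ {n} → (Fin n → Fin n → ℕ) → ℕ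
∑< {n} f = ∑[ i < n ] ∑[ j < n ] ((i <ᶠ j) ·ᵇ f i j)

∑<-mono-≤ : ∀ {n} {f g : Fin n → Fin n → ℕ} → (∀ i j → f i j ≤ g i j) → ∑< f ≤ ∑< g
∑<-mono-≤ f≤g = ∑-mono-≤ λ i → ∑-mono-≤ λ j → ·ᵇ-mono (f≤g i j)
  where
  ·ᵇ-mono : ∀ {b x y} → x ≤ y → b ·ᵇ x ≤ b ·ᵇ y
  ·ᵇ-mono {true}  x≤y = x≤y
  ·ᵇ-mono {false} x≤y = z≤n

∑<-cong : ∀ {n} {f g : Fin n → Fin n → ℕ} → (∀ i j → f i j ≡ g i j) → ∑< f ≡ ∑< g
∑<-cong f≡g = sum-cong-≗ λ i → sum-cong-≗ λ j → cong ((i <ᶠ j) ·ᵇ_) (f≡g i j)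

∑<-distrib-+ : ∀ {n} (f g : Fin n → Fin n → ℕ) → ∑< (λ i j → f i j + g i j) ≡ ∑< f + ∑< g
∑<-distrib-+ {n} f g =
  trans (sum-cong-≗ λ i → trans (sum-cong-≗ λ j → ·ᵇ-+ (i <ᶠ j))
                                (∑-distrib-+ (λ j → (i <ᶠ j) ·ᵇ f i j) (λ j → (i <ᶠ j) ·ᵇ g i j)))
        (∑-distrib-+ (λ i → ∑[ j < n ] ((i <ᶠ j) ·ᵇ f i j)) (λ i → ∑[ j < n ] ((i <ᶠ j) ·ᵇ g i j)))
  where
  ·ᵇ-+ : ∀ b {x y} → b ·ᵇ (x + y) ≡ b ·ᵇ x + b ·ᵇ y
  ·ᵇ-+ true  = refl
  ·ᵇ-+ false = refl

∑-∑< : ∀ {r n} (f : Fin r → Fin n → Fin n → ℕ) →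
       ∑[ t < r ] ∑< (f t) ≡ ∑< (λ i j → ∑[ t < r ] f t i j)
∑-∑< {r} {n} f =
  trans (∑-comm (λ t i → ∑[ j < n ] ((i <ᶠ j) ·ᵇ f t i j)))
        (sum-cong-≗ λ i → trans (∑-comm (λ t j → (i <ᶠ j) ·ᵇ f t i j))
                                (sum-cong-≗ λ j → sym (·ᵇ-distrib-∑ (i <ᶠ j) (λ t → f t i j))))

∑<-sym-≤ : ∀ {n} (f : Fin n → Fin n → ℕ) →
           ∑< (λ i j → f i j + f j i) ≤ ∑[ i < n ] ∑[ j < n ] f i j
∑<-sym-≤ {zero}  f = z≤n
∑<-sym-≤ {suc n} f = begin
  ∑[ j < n ] (f₀ j + f′ j) + ∑< (λ i j → g i j + g j i)
    ≤⟨ +-mono-≤ (≤-reflexive (∑-distrib-+ f₀ f′)) (∑<-sym-≤ g) ⟩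
  (sum f₀ + sum f′) + ∑[ i < n ] sum (g i)
    ≤⟨ +-monoʳ-≤ (sum f₀ + sum f′) (m≤n+m _ (f fzero fzero)) ⟩
  (sum f₀ + sum f′) + (f fzero fzero + ∑[ i < n ] sum (g i))
    ≡⟨ shuffle (sum f₀) (sum f′) (f fzero fzero) (∑[ i < n ] sum (g i)) ⟩
  (f fzero fzero + sum f₀) + (sum f′ + ∑[ i < n ] sum (g i))
    ≡⟨ cong ((f fzero fzero + sum f₀) +_) (sym (∑-distrib-+ f′ (sum ∘ g))) ⟩
  ∑[ i < suc n ] ∑[ j < suc n ] f i j ∎
  where
  open ≤-Reasoning
  f₀ f′ : Fin n → ℕ
  f₀ j = f fzero (fsuc j)
  f′ j = f (fsuc j) fzero
  g : Fin n → Fin n → ℕ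
  g i j = f (fsuc i) (fsuc j)
  shuffle : ∀ a b c e → (a + b) + (c + e) ≡ (c + a) + (b + e)
  shuffle = solve-∀

pairCount≡∑< : ∀ {n} (R : Fin n → Fin n → Bool) → pairCount R ≡ ∑< (λ i j → 𝟙 (R i j))
pairCount≡∑< {n} R =
  trans (sum-tabulate row (λ i → i))
        (sum-cong-≗ λ i → trans (sum-tabulate (entry i) (λ j → j))
                                (sum-cong-≗ λ j → ·ᵇ-∧ (i <ᶠ j) (R i j) 1))
  where
  entry : Fin n → Fin n → ℕ
  entry i j = if (i <ᶠ j) ∧ R i j then 1 else 0
  row : Fin n → ℕ
  row i = sumℕ (map (entry i) (List.allFin n))

-- Subsets and hinge sums

_⊆ᵇ_ : ∀ {n} → Subset n → Subset n → Bool
p ⊆ᵇ q = does (p ⊆? q)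

∑-·ᵇ-size : ∀ {n} (p : Subset n) c → ∑[ v < n ] (lookup p v ·ᵇ c) ≡ ∣ p ∣ * c
∑-·ᵇ-size []            c = refl
∑-·ᵇ-size (inside  ∷ p) c = cong (c +_) (∑-·ᵇ-size p c)
∑-·ᵇ-size (outside ∷ p) c = ∑-·ᵇ-size p c

∣p∣≡∑ : ∀ {n} (p : Subset n) → ∣ p ∣ ≡ ∑[ v < n ] 𝟙 (lookup p v)
∣p∣≡∑ p = sym (trans (∑-·ᵇ-size p 1) (*-identityʳ ∣ p ∣))

∑<-inside : ∀ {n} (p : Subset n) c →
            ∑< (λ i j → (lookup p i ∧ lookup p j) ·ᵇ c) ≡ (∣ p ∣ C 2) * c
∑<-inside []            c = refl
∑<-inside {suc n} (inside  ∷ p) c = begin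
  ∑[ j < n ] (lookup p j ·ᵇ c) + ∑< (λ i j → (lookup p i ∧ lookup p j) ·ᵇ c)
    ≡⟨ cong₂ _+_ (∑-·ᵇ-size p c) (∑<-inside p c) ⟩
  ∣ p ∣ * c + (∣ p ∣ C 2) * c
    ≡⟨ sym (*-distribʳ-+ c ∣ p ∣ (∣ p ∣ C 2)) ⟩
  (∣ p ∣ + (∣ p ∣ C 2)) * c
    ≡⟨ cong (_* c) (C2-suc ∣ p ∣) ⟩
  (suc ∣ p ∣ C 2) * c ∎
  where open ≡-Reasoning
∑<-inside {suc n} (outside ∷ p) c = cong₂ _+_ (sum-replicate-zero n) (∑<-inside p c)

⊆-insert : ∀ {n} (p : Subset n) i → p ⊆ p [ i ]≔ inside
⊆-insert (_ ∷ p) fzero    here      = here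
⊆-insert (_ ∷ p) fzero    (there e) = there e
⊆-insert (_ ∷ p) (fsuc i) here      = here
⊆-insert (_ ∷ p) (fsuc i) (there e) = there (⊆-insert p i e)

⊆-lookup : ∀ {n} {p q : Subset n} → p ⊆ q → ∀ {i} → lookup p i ≡ true → lookup q i ≡ true
⊆-lookup {p = p} {q} p⊆q {i} pᵢ = []=⇒lookup (p⊆q (lookup⇒[]= i p pᵢ))

⊆ᵇ-insert : ∀ {n} (p q : Subset n) v → (p [ v ]≔ inside) ⊆ᵇ q ≡ p ⊆ᵇ q ∧ lookup q v
⊆ᵇ-insert (outside ∷ p) (inside  ∷ q) fzero    = sym (∧-identityʳ (p ⊆ᵇ q))
⊆ᵇ-insert (outside ∷ p) (outside ∷ q) fzero    = sym (∧-zeroʳ (p ⊆ᵇ q))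
⊆ᵇ-insert (inside  ∷ p) (inside  ∷ q) fzero    = sym (∧-identityʳ (p ⊆ᵇ q))
⊆ᵇ-insert (inside  ∷ p) (outside ∷ q) fzero    = refl
⊆ᵇ-insert (outside ∷ p) (_       ∷ q) (fsuc v) = ⊆ᵇ-insert p q v
⊆ᵇ-insert (inside  ∷ p) (inside  ∷ q) (fsuc v) = ⊆ᵇ-insert p q v
⊆ᵇ-insert (inside  ∷ p) (outside ∷ q) (fsuc v) = refl

module _ {A : Set} {p} {P : Pred A p} (P? : Decidable P) where

  length-filter≡∑ : ∀ xs → length (filter P? xs) ≡ ∑[ t < length xs ] 𝟙 (does (P? (List.lookup xs t)))
  length-filter≡∑ []       = refl
  length-filter≡∑ (x ∷ xs) with does (P? x)
  ... | true  = cong suc (length-filter≡∑ xs)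
  ... | false = length-filter≡∑ xs

  filter-absorb : ∀ {q} {Q : Pred A q} (Q? : Decidable Q) → (∀ {x} → P x → Q x) →
                  ∀ xs → filter P? (filter Q? xs) ≡ filter P? xs
  filter-absorb Q? P⇒Q []       = refl
  filter-absorb Q? P⇒Q (x ∷ xs) with Q? x
  ... | no ¬Qx = trans (filter-absorb Q? P⇒Q xs) (sym (filter-reject P? (¬Qx ∘ P⇒Q)))
  ... | yes _ with does (P? x)
  ...   | true  = cong (x ∷_) (filter-absorb Q? P⇒Q xs)
  ...   | false = filter-absorb Q? P⇒Q xs

∑ᴸ : {A : Set} → List A → (A → ℕ) → ℕ
∑ᴸ []       f = 0
∑ᴸ (x ∷ xs) f = f x + ∑ᴸ xs f

∑ᴸ-cong : ∀ {A : Set} (xs : List A) {f g : A → ℕ} → (∀ x → f x ≡ g x) → ∑ᴸ xs f ≡ ∑ᴸ xs g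
∑ᴸ-cong []       f≡g = refl
∑ᴸ-cong (x ∷ xs) f≡g = cong₂ _+_ (f≡g x) (∑ᴸ-cong xs f≡g)

∑ᴸ-zero : ∀ {A : Set} (xs : List A) → ∑ᴸ xs (λ _ → 0) ≡ 0
∑ᴸ-zero []       = refl
∑ᴸ-zero (x ∷ xs) = ∑ᴸ-zero xs

∑ᴸ-++ : ∀ {A : Set} (xs ys : List A) f → ∑ᴸ (xs ++ ys) f ≡ ∑ᴸ xs f + ∑ᴸ ys f
∑ᴸ-++ []       ys f = refl
∑ᴸ-++ (x ∷ xs) ys f = trans (cong (f x +_) (∑ᴸ-++ xs ys f)) (sym (+-assoc (f x) _ _))

∑ᴸ-map : ∀ {A B : Set} (g : A → B) (xs : List A) f → ∑ᴸ (map g xs) f ≡ ∑ᴸ xs (f ∘ g)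
∑ᴸ-map g []       f = refl
∑ᴸ-map g (x ∷ xs) f = cong (f (g x) +_) (∑ᴸ-map g xs f)

∑ᴸ-allSubsets : ∀ {n} (f : Subset (suc n) → ℕ) →
                ∑ᴸ (allSubsets (suc n)) f ≡
                ∑ᴸ (allSubsets n) (f ∘ (inside ∷_)) + ∑ᴸ (allSubsets n) (f ∘ (outside ∷_))
∑ᴸ-allSubsets {n} f = trans (∑ᴸ-++ (map (inside ∷_) (allSubsets n)) _ f)
  (cong₂ _+_ (∑ᴸ-map (inside ∷_) (allSubsets n) f) (∑ᴸ-map (outside ∷_) (allSubsets n) f))

extends : ∀ {n} → ℕ → Subset n → Subset n → Bool
extends s W U = W ⊆ᵇ U ∧ does (∣ U ∣ ≟ s + ∣ W ∣)

∑⊇ : ∀ {n} → ℕ → Subset n → (Subset n → ℕ) → ℕ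
∑⊇ {n} s W G = ∑ᴸ (allSubsets n) (λ U → extends s W U ·ᵇ G U)

∑⊇-0 : ∀ {n} (W : Subset n) G → ∑⊇ 0 W G ≡ G W
∑⊇-0 []                    G = +-identityʳ (G [])
∑⊇-0 {suc n} (inside  ∷ W) G = trans (∑ᴸ-allSubsets λ U → extends 0 (inside ∷ W) U ·ᵇ G U)
  (trans (cong₂ _+_ (∑⊇-0 W (G ∘ (inside ∷_))) (∑ᴸ-zero (allSubsets n))) (+-identityʳ _))
∑⊇-0 {suc n} (outside ∷ W) G = trans (∑ᴸ-allSubsets λ U → extends 0 (outside ∷ W) U ·ᵇ G U)
  (cong₂ _+_ (trans (∑ᴸ-cong (allSubsets n) λ U → cong (_·ᵇ G (inside ∷ U)) (too-large U))
                    (∑ᴸ-zero (allSubsets n)))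
             (∑⊇-0 W (G ∘ (outside ∷_))))
  where
  too-large : ∀ U → extends 0 (outside ∷ W) (inside ∷ U) ≡ false
  too-large U with W ⊆? U
  ... | no  _   = refl
  ... | yes W⊆U = dec-false (suc ∣ U ∣ ≟ ∣ W ∣) λ eq →
    1+n≰n (≤-trans (≤-reflexive eq) (p⊆q⇒∣p∣≤∣q∣ W⊆U))

∑⊇-1 : ∀ {n} (W : Subset n) G →
       ∑⊇ 1 W G ≡ ∑[ v < n ] (not (lookup W v) ·ᵇ G (W [ v ]≔ inside))
∑⊇-1 []                    G = refl
∑⊇-1 {suc n} (inside  ∷ W) G = trans (∑ᴸ-allSubsets λ U → extends 1 (inside ∷ W) U ·ᵇ G U)
  (trans (cong₂ _+_ (∑⊇-1 W (G ∘ (inside ∷_))) (∑ᴸ-zero (allSubsets n))) (+-identityʳ _))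
∑⊇-1 {suc n} (outside ∷ W) G = trans (∑ᴸ-allSubsets λ U → extends 1 (outside ∷ W) U ·ᵇ G U)
  (cong₂ _+_ (∑⊇-0 W (G ∘ (inside ∷_))) (∑⊇-1 W (G ∘ (outside ∷_))))

∑⊇-2 : ∀ {n} (W : Subset n) G →
       ∑⊇ 2 W G ≡
       ∑< (λ i j → (not (lookup W i) ∧ not (lookup W j)) ·ᵇ G ((W [ i ]≔ inside) [ j ]≔ inside))
∑⊇-2 []                    G = refl
∑⊇-2 {suc n} (inside  ∷ W) G = trans (∑ᴸ-allSubsets λ U → extends 2 (inside ∷ W) U ·ᵇ G U)
  (trans (+-comm (∑⊇ 2 W (G ∘ (inside ∷_))) (∑ᴸ (allSubsets n) (λ _ → 0)))
         (cong₂ _+_ (trans (∑ᴸ-zero (allSubsets n)) (sym (sum-replicate-zero n)))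
                    (∑⊇-2 W (G ∘ (inside ∷_)))))
∑⊇-2 {suc n} (outside ∷ W) G = trans (∑ᴸ-allSubsets λ U → extends 2 (outside ∷ W) U ·ᵇ G U)
  (cong₂ _+_ (∑⊇-1 W (G ∘ (inside ∷_))) (∑⊇-2 W (G ∘ (outside ∷_))))

⊆∧∣∣<⇒⊂ : ∀ {n} {p q : Subset n} → p ⊆ q → ∣ p ∣ < ∣ q ∣ → p ⊂ q
⊆∧∣∣<⇒⊂ p⊆q ∣p∣<∣q∣ = p⊆q , new-element p⊆q ∣p∣<∣q∣
  where
  new-element : ∀ {n} {p q : Subset n} → p ⊆ q → ∣ p ∣ < ∣ q ∣ → ∃ λ x → x ∈ q × x ∉ p
  new-element {p = outside ∷ p} {inside  ∷ q} _ _ = fzero , here , λ ()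
  new-element {p = outside ∷ p} {outside ∷ q} p⊆q ∣p∣<∣q∣
    with x , x∈q , x∉p ← new-element (drop-∷-⊆ p⊆q) ∣p∣<∣q∣ = fsuc x , there x∈q , x∉p ∘ drop-there
  new-element {p = inside  ∷ p} {inside  ∷ q} p⊆q (s≤s ∣p∣<∣q∣)
    with x , x∈q , x∉p ← new-element (drop-∷-⊆ p⊆q) ∣p∣<∣q∣ = fsuc x , there x∈q , x∉p ∘ drop-there
  new-element {p = inside  ∷ p} {outside ∷ q} p⊆q _ with () ← p⊆q here

sumℤ-filter : ∀ {A : Set} {p} {P : Pred A p} (P? : Decidable P) (h : A → ℤ) (g : A → ℕ) →
              (∀ x → P x → h x ≡ ℤ.+ g x) → ∀ xs →
              sumℤ (map h (filter P? xs)) ≡ ℤ.+ ∑ᴸ xs (λ x → does (P? x) ·ᵇ g x)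
sumℤ-filter P? h g h≡g []       = refl
sumℤ-filter P? h g h≡g (x ∷ xs) with P? x
... | yes Px = cong₂ ℤ._+_ (h≡g x Px) (sumℤ-filter P? h g h≡g xs)
... | no  _  = sumℤ-filter P? h g h≡g xs

+m-+1≡+[m∸1] : ∀ {m} → 1 ≤ m → (ℤ.+ m) ℤ.- (ℤ.+ 1) ≡ ℤ.+ (m ∸ 1)
+m-+1≡+[m∸1] {m} 1≤m = trans (ℤ.m-n≡m⊖n m 1) (ℤ.⊖-≥ 1≤m)

-- A superset U with d(U) ≤ 1 contributes d(U) ∸ 1 = 0, so the condition
-- 2 ≤ d(U) of a hinge can be dropped.
hingeSum≡∑⊇ : ∀ {n} (Xs : List (Subset n)) s (W : Subset n) → 1 ≤ s →
              hingeSum Xs (s + ∣ W ∣) W ≡ ℤ.+ ∑⊇ s W (λ U → deg Xs U ∸ 1)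
hingeSum≡∑⊇ {n} Xs s W 1≤s =
  trans (sumℤ-filter (λ U → hinge? Xs (s + ∣ W ∣) U ×-dec W ⊂? U) _ (λ U → deg Xs U ∸ 1)
                     (λ U ((_ , 2≤deg) , _) → +m-+1≡+[m∸1] (≤-trans (n≤1+n 1) 2≤deg)) (allSubsets n))
        (cong ℤ.+_ (∑ᴸ-cong (allSubsets n) weight))
  where
  weight : ∀ U → does (hinge? Xs (s + ∣ W ∣) U ×-dec W ⊂? U) ·ᵇ (deg Xs U ∸ 1)
                 ≡ extends s W U ·ᵇ (deg Xs U ∸ 1)
  weight U = weight′ (hinge? Xs (s + ∣ W ∣) U ×-dec W ⊂? U) (∣ U ∣ ≟ s + ∣ W ∣)
    where
    weight′ : (h? : Dec (Hinge Xs (s + ∣ W ∣) U × W ⊂ U)) (e? : Dec (∣ U ∣ ≡ s + ∣ W ∣)) →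
              does h? ·ᵇ (deg Xs U ∸ 1) ≡ (W ⊆ᵇ U ∧ does e?) ·ᵇ (deg Xs U ∸ 1)
    weight′ (yes ((_ , _) , (W⊆U , _))) (yes _) rewrite dec-true (W ⊆? U) W⊆U = refl
    weight′ (yes ((∣U∣≡ , _) , _)) (no ∣U∣≢) with () ← ∣U∣≢ ∣U∣≡
    weight′ (no ¬hinge) e? with W ⊆? U | e?
    ... | no _    | _        = refl
    ... | yes _   | no _     = refl
    ... | yes W⊆U | yes ∣U∣≡ = sym (m≤n⇒m∸n≡0 (≤-pred (≰⇒> λ 2≤deg →
      ¬hinge ((∣U∣≡ , 2≤deg) , ⊆∧∣∣<⇒⊂ W⊆U (subst (∣ W ∣ <_) (sym ∣U∣≡) (m<n+m ∣ W ∣ 1≤s))))))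

-- Double counting over the components through a hinge

module Incidence {n r : ℕ} (X : Fin r → Subset n) where

  multiplicity : Fin n → ℕ
  multiplicity v = ∑[ t < r ] 𝟙 (lookup (X t) v)

  pairMultiplicity : Fin n → Fin n → ℕ
  pairMultiplicity i j = ∑[ t < r ] 𝟙 (lookup (X t) i ∧ lookup (X t) j)

  union : Subset n
  union = tabulate (λ v → 0 <ᵇ multiplicity v)

  lookup-union : ∀ v → 1 ≤ multiplicity v → lookup union v ≡ true
  lookup-union v 1≤m = trans (lookup∘tabulate _ v) (0<ᵇ (multiplicity v) 1≤m)
    where
    0<ᵇ : ∀ m → 1 ≤ m → (0 <ᵇ m) ≡ true
    0<ᵇ (suc m) _ = refl

  pairMultiplicity≤ˡ : ∀ i j → pairMultiplicity i j ≤ multiplicity i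
  pairMultiplicity≤ˡ i j = ∑-mono-≤ λ t → 𝟙≤𝟙 (∧-conicalˡ (lookup (X t) i) (lookup (X t) j))

  pairMultiplicity≤ʳ : ∀ i j → pairMultiplicity i j ≤ multiplicity j
  pairMultiplicity≤ʳ i j = ∑-mono-≤ λ t → 𝟙≤𝟙 (∧-conicalʳ (lookup (X t) i) (lookup (X t) j))

  X⊆union : ∀ t → X t ⊆ union
  X⊆union t {v} v∈X = lookup⇒[]= v union (lookup-union v
    (≤-trans (𝟙≤𝟙 {true} λ _ → []=⇒lookup v∈X) (term≤∑ (λ s → 𝟙 (lookup (X s) v)) t)))

  ∑-size : ∑[ t < r ] ∣ X t ∣ ≡ ∣ union ∣ + ∑[ v < n ] (multiplicity v ∸ 1)
  ∑-size = begin
    ∑[ t < r ] ∣ X t ∣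
      ≡⟨ sum-cong-≗ (∣p∣≡∑ ∘ X) ⟩
    ∑[ t < r ] ∑[ v < n ] 𝟙 (lookup (X t) v)
      ≡⟨ ∑-comm (λ t v → 𝟙 (lookup (X t) v)) ⟩
    ∑[ v < n ] multiplicity v
      ≡⟨ sum-cong-≗ (m≡𝟙[0<m]+[m∸1] ∘ multiplicity) ⟩
    ∑[ v < n ] (𝟙 (0 <ᵇ multiplicity v) + (multiplicity v ∸ 1))
      ≡⟨ ∑-distrib-+ (λ v → 𝟙 (0 <ᵇ multiplicity v)) (λ v → multiplicity v ∸ 1) ⟩
    ∑[ v < n ] 𝟙 (0 <ᵇ multiplicity v) + ∑[ v < n ] (multiplicity v ∸ 1)
      ≡⟨ cong (_+ excess) (sum-cong-≗ λ v → cong 𝟙 (lookup∘tabulate (λ u → 0 <ᵇ multiplicity u) v)) ⟨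
    ∑[ v < n ] 𝟙 (lookup union v) + excess
      ≡⟨ cong (_+ excess) (∣p∣≡∑ union) ⟨
    ∣ union ∣ + excess ∎
    where
    open ≡-Reasoning
    excess : ℕ
    excess = ∑[ v < n ] (multiplicity v ∸ 1)

  ∑-iH-≤ : (H : Graph n) →
           ∑[ t < r ] iH H (X t) ≤ iH H union + ∑< (λ i j → pairMultiplicity i j ∸ 1)
  ∑-iH-≤ H = begin
    ∑[ t < r ] iH H (X t)
      ≡⟨ sum-cong-≗ (λ t → pairCount≡∑< (edgeIn (X t))) ⟩
    ∑[ t < r ] ∑< (λ i j → 𝟙 (edgeIn (X t) i j))
      ≡⟨ ∑-∑< (λ t i j → 𝟙 (edgeIn (X t) i j)) ⟩
    ∑< (λ i j → ∑[ t < r ] 𝟙 (edgeIn (X t) i j))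
      ≤⟨ ∑<-mono-≤ edges-≤ ⟩
    ∑< (λ i j → 𝟙 (edgeIn union i j) + (pairMultiplicity i j ∸ 1))
      ≡⟨ ∑<-distrib-+ (λ i j → 𝟙 (edgeIn union i j)) (λ i j → pairMultiplicity i j ∸ 1) ⟩
    ∑< (λ i j → 𝟙 (edgeIn union i j)) + ∑< (λ i j → pairMultiplicity i j ∸ 1)
      ≡⟨ cong (_+ _) (pairCount≡∑< (edgeIn union)) ⟨
    iH H union + ∑< (λ i j → pairMultiplicity i j ∸ 1) ∎
    where
    open ≤-Reasoning
    edgeIn : Subset n → Fin n → Fin n → Bool
    edgeIn Y i j = adj H i j ∧ (lookup Y i ∧ lookup Y j)

    pair⇒union : ∀ i j → 1 ≤ pairMultiplicity i j → (lookup union i ∧ lookup union j) ≡ true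
    pair⇒union i j 1≤pm = cong₂ _∧_ (lookup-union i (≤-trans 1≤pm (pairMultiplicity≤ˡ i j)))
                                    (lookup-union j (≤-trans 1≤pm (pairMultiplicity≤ʳ i j)))

    edges-≤ : ∀ i j → ∑[ t < r ] 𝟙 (edgeIn (X t) i j) ≤ 𝟙 (edgeIn union i j) + (pairMultiplicity i j ∸ 1)
    edges-≤ i j with adj H i j
    ... | true  = m≤𝟙+[m∸1] (pairMultiplicity i j) (pair⇒union i j)
    ... | false = ≤-trans (≤-reflexive (sum-replicate-zero r)) z≤n

module AtHinge {n} (Xs : List (Subset n)) (W : Subset n) where

  𝒳 : List (Subset n)
  𝒳 = filter (W ⊆?_) Xs

  X : Fin (deg Xs W) → Subset n
  X = List.lookup 𝒳

  open Incidence X public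

  X∈Xs : ∀ t → X t ∈ₗ Xs
  X∈Xs t = proj₁ (∈-filter⁻ (W ⊆?_) (∈-lookup t))

  W⊆X : ∀ t → W ⊆ X t
  W⊆X t = proj₂ (∈-filter⁻ (W ⊆?_) {xs = Xs} (∈-lookup t))

  deg-⊇ : ∀ {U} → W ⊆ U → deg Xs U ≡ ∑[ t < deg Xs W ] 𝟙 (U ⊆ᵇ X t)
  deg-⊇ {U} W⊆U = trans (cong length (sym (filter-absorb (U ⊆?_) (W ⊆?_) (⊆-trans W⊆U) Xs)))
                        (length-filter≡∑ (U ⊆?_) 𝒳)

  W⊆ᵇX : ∀ t → W ⊆ᵇ X t ≡ true
  W⊆ᵇX t = dec-true (W ⊆? X t) (W⊆X t)

  multiplicity≡deg : ∀ v → multiplicity v ≡ deg Xs (W [ v ]≔ inside)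
  multiplicity≡deg v = sym (trans (deg-⊇ (⊆-insert W v)) (sum-cong-≗ λ t →
    cong 𝟙 (trans (⊆ᵇ-insert W (X t) v) (cong (_∧ lookup (X t) v) (W⊆ᵇX t)))))

  pairMultiplicity≡deg : ∀ i j → pairMultiplicity i j ≡ deg Xs ((W [ i ]≔ inside) [ j ]≔ inside)
  pairMultiplicity≡deg i j =
    sym (trans (deg-⊇ (⊆-trans (⊆-insert W i) (⊆-insert _ j))) (sum-cong-≗ λ t →
      cong 𝟙 (trans (⊆ᵇ-insert (W [ i ]≔ inside) (X t) j)
                    (cong (_∧ lookup (X t) j) (trans (⊆ᵇ-insert W (X t) i)
                                                     (cong (_∧ lookup (X t) i) (W⊆ᵇX t)))))))

  multiplicity-∈W : ∀ {v} → lookup W v ≡ true → multiplicity v ≡ deg Xs W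
  multiplicity-∈W v∈W = trans (sum-cong-≗ λ t → cong 𝟙 (⊆-lookup (W⊆X t) v∈W))
                              (trans (∑-const (deg Xs W) 1) (*-identityʳ (deg Xs W)))

  pairMultiplicity-∈Wˡ : ∀ {i} j → lookup W i ≡ true → pairMultiplicity i j ≡ multiplicity j
  pairMultiplicity-∈Wˡ j i∈W = sum-cong-≗ λ t →
    cong (λ b → 𝟙 (b ∧ lookup (X t) j)) (⊆-lookup (W⊆X t) i∈W)

  pairMultiplicity-∈Wʳ : ∀ i {j} → lookup W j ≡ true → pairMultiplicity i j ≡ multiplicity i
  pairMultiplicity-∈Wʳ i j∈W = sum-cong-≗ λ t →
    cong 𝟙 (trans (cong (lookup (X t) i ∧_) (⊆-lookup (W⊆X t) j∈W)) (∧-identityʳ _))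

  hingeSum₁ hingeSum₂ : ℕ
  hingeSum₁ = ∑[ v < n ] (not (lookup W v) ·ᵇ (multiplicity v ∸ 1))
  hingeSum₂ = ∑< (λ i j → (not (lookup W i) ∧ not (lookup W j)) ·ᵇ (pairMultiplicity i j ∸ 1))

  hingeSum₁-eq : hingeSum Xs (suc ∣ W ∣) W ≡ ℤ.+ hingeSum₁
  hingeSum₁-eq = trans (hingeSum≡∑⊇ Xs 1 W (s≤s z≤n)) (cong ℤ.+_ (trans (∑⊇-1 W _) (sum-cong-≗ λ v →
    cong (λ m → not (lookup W v) ·ᵇ (m ∸ 1)) (sym (multiplicity≡deg v)))))

  hingeSum₂-eq : hingeSum Xs (suc (suc ∣ W ∣)) W ≡ ℤ.+ hingeSum₂
  hingeSum₂-eq = trans (hingeSum≡∑⊇ Xs 2 W (s≤s z≤n)) (cong ℤ.+_ (trans (∑⊇-2 W _) (∑<-cong λ i j →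
    cong (λ m → (not (lookup W i) ∧ not (lookup W j)) ·ᵇ (m ∸ 1)) (sym (pairMultiplicity≡deg i j)))))

  ∑-excess : ∑[ v < n ] (multiplicity v ∸ 1) ≡ ∣ W ∣ * (deg Xs W ∸ 1) + hingeSum₁
  ∑-excess = begin
    ∑[ v < n ] (multiplicity v ∸ 1)
      ≡⟨ sum-cong-≗ split ⟩
    ∑[ v < n ] (lookup W v ·ᵇ (deg Xs W ∸ 1) + not (lookup W v) ·ᵇ (multiplicity v ∸ 1))
      ≡⟨ ∑-distrib-+ (λ v → lookup W v ·ᵇ (deg Xs W ∸ 1))
                     (λ v → not (lookup W v) ·ᵇ (multiplicity v ∸ 1)) ⟩
    ∑[ v < n ] (lookup W v ·ᵇ (deg Xs W ∸ 1)) + hingeSum₁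
      ≡⟨ cong (_+ hingeSum₁) (∑-·ᵇ-size W (deg Xs W ∸ 1)) ⟩
    ∣ W ∣ * (deg Xs W ∸ 1) + hingeSum₁ ∎
    where
    open ≡-Reasoning
    split : ∀ v → multiplicity v ∸ 1
                  ≡ lookup W v ·ᵇ (deg Xs W ∸ 1) + not (lookup W v) ·ᵇ (multiplicity v ∸ 1)
    split v with lookup W v in v∈W
    ... | true  = trans (cong (_∸ 1) (multiplicity-∈W v∈W)) (sym (+-identityʳ _))
    ... | false = refl

  ∑<-excess-≤ : ∑< (λ i j → pairMultiplicity i j ∸ 1)
                ≤ (∣ W ∣ C 2) * (deg Xs W ∸ 1) + ∣ W ∣ * hingeSum₁ + hingeSum₂
  ∑<-excess-≤ = begin
    ∑< (λ i j → pairMultiplicity i j ∸ 1)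
      ≡⟨ ∑<-cong split ⟩
    ∑< (λ i j → both i j + (mixed i j + mixed j i) + neither i j)
      ≡⟨ ∑<-distrib-+ (λ i j → both i j + (mixed i j + mixed j i)) neither ⟩
    ∑< (λ i j → both i j + (mixed i j + mixed j i)) + hingeSum₂
      ≡⟨ cong (_+ hingeSum₂) (∑<-distrib-+ both (λ i j → mixed i j + mixed j i)) ⟩
    ∑< both + ∑< (λ i j → mixed i j + mixed j i) + hingeSum₂
      ≤⟨ +-monoˡ-≤ hingeSum₂ (+-mono-≤ (≤-reflexive (∑<-inside W (deg Xs W ∸ 1))) (∑<-sym-≤ mixed)) ⟩
    (∣ W ∣ C 2) * (deg Xs W ∸ 1) + ∑[ i < n ] ∑[ j < n ] mixed i j + hingeSum₂
      ≡⟨ cong (λ z → (∣ W ∣ C 2) * (deg Xs W ∸ 1) + z + hingeSum₂) mixed-total ⟩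
    (∣ W ∣ C 2) * (deg Xs W ∸ 1) + ∣ W ∣ * hingeSum₁ + hingeSum₂ ∎
    where
    open ≤-Reasoning
    both mixed neither : Fin n → Fin n → ℕ
    both    i j = (lookup W i ∧ lookup W j) ·ᵇ (deg Xs W ∸ 1)
    mixed   i j = lookup W i ·ᵇ not (lookup W j) ·ᵇ (multiplicity j ∸ 1)
    neither i j = (not (lookup W i) ∧ not (lookup W j)) ·ᵇ (pairMultiplicity i j ∸ 1)

    split : ∀ i j → pairMultiplicity i j ∸ 1 ≡ both i j + (mixed i j + mixed j i) + neither i j
    split i j with lookup W i in i∈W | lookup W j in j∈W
    ... | true  | true  = trans (cong (_∸ 1) (trans (pairMultiplicity-∈Wˡ j i∈W) (multiplicity-∈W j∈W)))
                                (sym (trans (+-identityʳ _) (+-identityʳ _)))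
    ... | true  | false = trans (cong (_∸ 1) (pairMultiplicity-∈Wˡ j i∈W))
                                (sym (trans (+-identityʳ _) (+-identityʳ _)))
    ... | false | true  = trans (cong (_∸ 1) (pairMultiplicity-∈Wʳ i j∈W)) (sym (+-identityʳ _))
    ... | false | false = refl

    mixed-total : ∑[ i < n ] ∑[ j < n ] mixed i j ≡ ∣ W ∣ * hingeSum₁
    mixed-total = trans (sum-cong-≗ λ i → sym (·ᵇ-distrib-∑ (lookup W i) λ j →
                                               not (lookup W j) ·ᵇ (multiplicity j ∸ 1)))
                        (∑-·ᵇ-size W hingeSum₁)

  ∑-iH-≤-hinges : (H : Graph n) → ∑[ t < deg Xs W ] iH H (X t)
                  ≤ iH H union + ((∣ W ∣ C 2) * (deg Xs W ∸ 1) + ∣ W ∣ * hingeSum₁ + hingeSum₂)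
  ∑-iH-≤-hinges H = ≤-trans (∑-iH-≤ H) (+-monoʳ-≤ (iH H union) ∑<-excess-≤)

-- Critical subgraphs of a sparse graph

module _ {n} {H : Graph n} where

  induced : Subset n → Subgraph H
  induced Y = record
    { U      = Y
    ; F      = λ i j → adj H i j ∧ (lookup Y i ∧ lookup Y j)
    ; F-sym  = λ i j → cong₂ _∧_ (adj-sym H i j) (∧-comm (lookup Y i) (lookup Y j))
    ; F⊆E    = λ i j → ∧-conicalˡ (adj H i j) _
    ; F-ends = λ i j e → ∧-conicalˡ (lookup Y i) _ (∧-conicalʳ (adj H i j) _ e)
    }

  ≤S-induced : ∀ (S : Subgraph H) Y → U S ⊆ Y → S ≤S induced Y
  ≤S-induced S Y U⊆Y = U⊆Y , edge
    where
    edge : ∀ i j → F S i j ≡ true → F (induced Y) i j ≡ true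
    edge i j Fᵢⱼ rewrite F⊆E S i j Fᵢⱼ
                       | ⊆-lookup U⊆Y (F-ends S i j Fᵢⱼ)
                       | ⊆-lookup U⊆Y (F-ends S j i (trans (F-sym S j i) Fᵢⱼ)) = refl

  edgeCount-mono : ∀ (S T : Subgraph H) → S ≤S T → edgeCount S ≤ edgeCount T
  edgeCount-mono S T (_ , F⊆F) =
    subst₂ _≤_ (sym (pairCount≡∑< (F S))) (sym (pairCount≡∑< (F T)))
               (∑<-mono-≤ λ i j → 𝟙≤𝟙 (F⊆F i j))

  critical-tight : ∀ {d} → 1 ≤ d → Sparse d H → ∀ (S : Subgraph H) → Critical d S →
                   suc (suc d) ≤ ∣ U S ∣ → iH H (U S) + (suc d C 2) ≡ d * ∣ U S ∣
  critical-tight {d} 1≤d sparse S (inj₁ (∣U∣≡2 , _)) large =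
    contradiction (≤-trans (s≤s (s≤s 1≤d)) (≤-trans large (≤-reflexive ∣U∣≡2))) (<-irrefl refl ∘ ≤-pred)
  critical-tight {d} 1≤d sparse S (inj₂ (_ , tight)) large =
    trans (cong (_+ (suc d C 2)) iH≡) (m∸n+n≡m (C2≤ d (≤-trans (n≤1+n (suc d)) large)))
    where
    iH≡ : iH H (U S) ≡ d * ∣ U S ∣ ∸ (suc d C 2)
    iH≡ = ≤-antisym (sparse (U S) (≤-trans (n≤1+n d) (≤-trans (n≤1+n (suc d)) large)))
                    (subst (_≤ iH H (U S)) tight (edgeCount-mono S (induced (U S)) (≤S-induced S (U S) ⊆-refl)))

  component-⊇-critical : ∀ {d} (S : Subgraph H) → Component d S →
                         ∀ (T : Subgraph H) → Critical d T → S ≤S T → U S ≡ U T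
  component-⊇-critical S (_ , maximal) T T-critical S≤T =
    decidable-stable (≡-dec Bool._≟_ (U S) (U T)) λ U≢ → maximal T T-critical (S≤T , U≢ ∘ proj₁)

  -- Were Y tight, its induced subgraph would be critical, and maximality would force
  -- both components to have vertex set Y.
  slack-⊇-two-components :
    ∀ {d} → Sparse d H → ∀ (S₁ S₂ : Subgraph H) → Component d S₁ → Component d S₂ →
    U S₁ ≢ U S₂ → ∀ {Y} → U S₁ ⊆ Y → U S₂ ⊆ Y → suc (suc d) ≤ ∣ Y ∣ →
    suc (iH H Y + (suc d C 2)) ≤ d * ∣ Y ∣
  slack-⊇-two-components {d} sparse S₁ S₂ comp₁ comp₂ U₁≢U₂ {Y} U₁⊆Y U₂⊆Y large =
    subst (suc (iH H Y + (suc d C 2)) ≤_) (m∸n+n≡m (C2≤ d (≤-trans (n≤1+n (suc d)) large)))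
          (+-monoˡ-≤ (suc d C 2) (≤∧≢⇒< (sparse Y d≤∣Y∣) not-tight))
    where
    d≤∣Y∣ : d ≤ ∣ Y ∣
    d≤∣Y∣ = ≤-trans (n≤1+n d) (≤-trans (n≤1+n (suc d)) large)

    not-tight : iH H Y ≢ d * ∣ Y ∣ ∸ (suc d C 2)
    not-tight tight = U₁≢U₂ (trans (U≡Y S₁ comp₁ U₁⊆Y) (sym (U≡Y S₂ comp₂ U₂⊆Y)))
      where
      U≡Y : ∀ S → Component d S → U S ⊆ Y → U S ≡ Y
      U≡Y S S-component U⊆Y =
        component-⊇-critical S S-component (induced Y) (inj₂ (large , tight)) (≤S-induced S Y U⊆Y)

-- The counting inequality

hinge-arithmetic :
  ∀ {k d} M S iY Cd Cₖ C′ σ₁ σ₂ Σedges → k ≤ d →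
  Σedges ≤ iY + (Cₖ * M + k * σ₁ + σ₂) →
  Σedges + suc M * Cd ≡ d * (S + (k * M + σ₁)) →
  suc (iY + Cd) ≤ d * S →
  Cₖ + Cd ≡ d * k + C′ →
  (d ∸ k) * σ₁ < C′ * M + σ₂
hinge-arithmetic {k} M S iY Cd Cₖ C′ σ₁ σ₂ Σedges k≤d edges tight slack binomial
  with e , refl ← m≤n⇒∃[o]m+o≡n k≤d rewrite m+n∸m≡n k e =
  +-cancelˡ-≤ (A + B + k * σ₁) _ _ (begin
    A + B + k * σ₁ + suc (e * σ₁)
      ≡⟨ shuffle₁ A B (k * σ₁) (e * σ₁) ⟩
    suc (A + (B + (k * σ₁ + e * σ₁)))
      ≡⟨ cong suc (trans (distrib k e M S σ₁) (sym tight)) ⟩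
    suc (Σedges + (Cd + M * Cd))
      ≤⟨ s≤s (+-monoˡ-≤ (Cd + M * Cd) edges) ⟩
    suc (iY + (Cₖ * M + k * σ₁ + σ₂) + (Cd + M * Cd))
      ≡⟨ shuffle₂ iY (Cₖ * M) (k * σ₁) σ₂ Cd (M * Cd) ⟩
    suc (iY + Cd) + (Cₖ * M + M * Cd + k * σ₁ + σ₂)
      ≤⟨ +-monoˡ-≤ (Cₖ * M + M * Cd + k * σ₁ + σ₂) slack ⟩
    A + (Cₖ * M + M * Cd + k * σ₁ + σ₂)
      ≡⟨ cong (λ x → A + (x + k * σ₁ + σ₂)) excess-pairs ⟩
    A + (B + C′ * M + k * σ₁ + σ₂)
      ≡⟨ shuffle₃ A B (C′ * M) (k * σ₁) σ₂ ⟩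
    A + B + k * σ₁ + (C′ * M + σ₂) ∎)
  where
  open ≤-Reasoning
  A B : ℕ
  A = (k + e) * S
  B = (k + e) * k * M

  excess-pairs : Cₖ * M + M * Cd ≡ B + C′ * M
  excess-pairs = begin-equality
    Cₖ * M + M * Cd         ≡⟨ cong (Cₖ * M +_) (*-comm M Cd) ⟩
    Cₖ * M + Cd * M         ≡⟨ *-distribʳ-+ M Cₖ Cd ⟨
    (Cₖ + Cd) * M           ≡⟨ cong (_* M) binomial ⟩
    ((k + e) * k + C′) * M  ≡⟨ *-distribʳ-+ M ((k + e) * k) C′ ⟩
    B + C′ * M              ∎

  distrib : ∀ k e M S σ₁ →
            (k + e) * S + ((k + e) * k * M + (k * σ₁ + e * σ₁)) ≡ (k + e) * (S + (k * M + σ₁))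
  distrib = solve-∀
  shuffle₁ : ∀ a b c x → a + b + c + suc x ≡ suc (a + (b + (c + x)))
  shuffle₁ = solve-∀
  shuffle₂ : ∀ i p c s x y → suc (i + (p + c + s) + (x + y)) ≡ suc (i + x) + (p + y + c + s)
  shuffle₂ = solve-∀
  shuffle₃ : ∀ a b r c s → a + (b + r + c + s) ≡ a + b + c + (r + s)
  shuffle₃ = solve-∀

ℕ<⇒ℤ< : ∀ {e σ₁ σ₂ c m} {a b m′ : ℤ} → a ≡ ℤ.+ σ₁ → b ≡ ℤ.+ σ₂ → m′ ≡ ℤ.+ m →
         e * σ₁ < c * m + σ₂ → (ℤ.+ e) ℤ.* a ℤ.- b ℤ.< (ℤ.+ c) ℤ.* m′
ℕ<⇒ℤ< {e} {σ₁} {σ₂} {c} {m} refl refl refl bound = begin-strict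
  (ℤ.+ e) ℤ.* (ℤ.+ σ₁) ℤ.- (ℤ.+ σ₂)         ≡⟨ cong (ℤ._- (ℤ.+ σ₂)) (ℤ.pos-* e σ₁) ⟨
  ℤ.+ (e * σ₁) ℤ.- (ℤ.+ σ₂)                 <⟨ ℤ.+-monoˡ-< (ℤ.- (ℤ.+ σ₂)) (ℤ.+<+ bound) ⟩
  ℤ.+ (c * m + σ₂) ℤ.- (ℤ.+ σ₂)             ≡⟨ cong (ℤ._- (ℤ.+ σ₂)) (ℤ.pos-+ (c * m) σ₂) ⟩
  (ℤ.+ (c * m)) ℤ.+ (ℤ.+ σ₂) ℤ.- (ℤ.+ σ₂)   ≡⟨ ℤ.+-assoc (ℤ.+ (c * m)) (ℤ.+ σ₂) (ℤ.- (ℤ.+ σ₂)) ⟩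
  (ℤ.+ (c * m)) ℤ.+ ((ℤ.+ σ₂) ℤ.- (ℤ.+ σ₂)) ≡⟨ cong (λ x → (ℤ.+ (c * m)) ℤ.+ x) (ℤ.+-inverseʳ (ℤ.+ σ₂)) ⟩
  (ℤ.+ (c * m)) ℤ.+ ℤ.0ℤ                    ≡⟨ ℤ.+-identityʳ (ℤ.+ (c * m)) ⟩
  ℤ.+ (c * m)                               ≡⟨ ℤ.pos-* c m ⟩
  (ℤ.+ c) ℤ.* (ℤ.+ m)                       ∎
  where open ℤ.≤-Reasoning

two-distinct-lookups : ∀ {A : Set} {xs : List A} → Unique xs → 2 ≤ length xs →
                       ∃₂ λ s t → List.lookup xs s ≢ List.lookup xs t
two-distinct-lookups {xs = []}        _                 ()
two-distinct-lookups {xs = _ ∷ []}    _                 (s≤s ())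
two-distinct-lookups {xs = _ ∷ _ ∷ _} ((x≢y ∷ _) ∷ _) _ = fzero , fsuc fzero , x≢y

module InCriticalCover {n d} {H : Graph n} (1≤d : 1 ≤ d) (sparse : Sparse d H)
  {Xs : List (Subset n)} (cover : IsCriticalCover d H Xs) (W : Subset n)
  (large : ∀ (S : Subgraph H) → Component d S → W ⊆ U S → suc (suc d) ≤ ∣ U S ∣) where

  open AtHinge Xs W

  component : ∀ t → CoverSet d H (X t)
  component t = Equivalence.to (proj₂ cover (X t)) (X∈Xs t)

  component-large : ∀ t (S : Subgraph H) → Component d S → U S ≡ X t → suc (suc d) ≤ ∣ U S ∣
  component-large t S S-component U≡X = large S S-component (subst (W ⊆_) (sym U≡X) (W⊆X t))

  X-large : ∀ t → suc (suc d) ≤ ∣ X t ∣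
  X-large t with S , S-component , U≡X ← component t =
    subst (λ Y → suc (suc d) ≤ ∣ Y ∣) U≡X (component-large t S S-component U≡X)

  ∑-tight : 1 ≤ deg Xs W → ∑[ t < deg Xs W ] iH H (X t) + suc (deg Xs W ∸ 1) * (suc d C 2)
                           ≡ d * (∣ union ∣ + (∣ W ∣ * (deg Xs W ∸ 1) + hingeSum₁))
  ∑-tight 1≤deg = begin
    ∑[ t < deg Xs W ] iH H (X t) + suc (deg Xs W ∸ 1) * (suc d C 2)
      ≡⟨ cong (λ m → ∑[ t < deg Xs W ] iH H (X t) + m * (suc d C 2))
              (trans (+-comm 1 (deg Xs W ∸ 1)) (m∸n+n≡m 1≤deg)) ⟩
    ∑[ t < deg Xs W ] iH H (X t) + deg Xs W * (suc d C 2)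
      ≡⟨ cong (∑[ t < deg Xs W ] iH H (X t) +_) (∑-const (deg Xs W) (suc d C 2)) ⟨
    ∑[ t < deg Xs W ] iH H (X t) + ∑[ t < deg Xs W ] (suc d C 2)
      ≡⟨ ∑-distrib-+ (λ t → iH H (X t)) (λ _ → suc d C 2) ⟨
    ∑[ t < deg Xs W ] (iH H (X t) + (suc d C 2))
      ≡⟨ sum-cong-≗ tight ⟩
    ∑[ t < deg Xs W ] (d * ∣ X t ∣)
      ≡⟨ *-distribˡ-sum d (λ t → ∣ X t ∣) ⟨
    d * ∑[ t < deg Xs W ] ∣ X t ∣
      ≡⟨ cong (d *_) (trans ∑-size (cong (∣ union ∣ +_) ∑-excess)) ⟩
    d * (∣ union ∣ + (∣ W ∣ * (deg Xs W ∸ 1) + hingeSum₁)) ∎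
    where
    open ≡-Reasoning
    tight : ∀ t → iH H (X t) + (suc d C 2) ≡ d * ∣ X t ∣
    tight t with S , S-component , U≡X ← component t =
      subst (λ Y → iH H Y + (suc d C 2) ≡ d * ∣ Y ∣) U≡X
            (critical-tight 1≤d sparse S (proj₁ S-component) (component-large t S S-component U≡X))

  union-slack : 2 ≤ deg Xs W → suc (iH H union + (suc d C 2)) ≤ d * ∣ union ∣
  union-slack 2≤deg with two-distinct-lookups (Unique.filter⁺ (W ⊆?_) (proj₁ cover)) 2≤deg
  ... | s , t , Xs≢Xt with component s | component t
  ... | S₁ , S₁-component , U₁≡Xs | S₂ , S₂-component , U₂≡Xt =
    slack-⊇-two-components sparse S₁ S₂ S₁-component S₂-component
      (λ U₁≡U₂ → Xs≢Xt (trans (sym U₁≡Xs) (trans U₁≡U₂ U₂≡Xt)))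
      (subst (_⊆ union) (sym U₁≡Xs) (X⊆union s)) (subst (_⊆ union) (sym U₂≡Xt) (X⊆union t))
      (≤-trans (X-large s) (p⊆q⇒∣p∣≤∣q∣ (X⊆union s)))

lemma3p2 : (n d k : ℕ) → 1 ≤ d → (H : Graph n) → Sparse d H
    → (Xs : List (Subset n)) → IsCriticalCover d H Xs
    → (W : Subset n) → Hinge Xs k W → k ≤ d ∸ 1
    → (∀ (S : Subgraph H) → Component d S → W ⊆ U S → suc (suc d) ≤ ∣ U S ∣)
    → ((ℤ.+ (d ∸ k)) ℤ.* hingeSum Xs (suc k) W) ℤ.- hingeSum Xs (suc (suc k)) W
    ℤ.< (ℤ.+ ((suc d ∸ k) C 2)) ℤ.* ((ℤ.+ deg Xs W) ℤ.- (ℤ.+ 1))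
lemma3p2 n d k 1≤d H sparse Xs cover W (refl , 2≤deg) k≤d∸1 large =
  ℕ<⇒ℤ< {e = d ∸ ∣ W ∣} {c = (suc d ∸ ∣ W ∣) C 2} hingeSum₁-eq hingeSum₂-eq (+m-+1≡+[m∸1] 1≤deg)
    (hinge-arithmetic (deg Xs W ∸ 1) ∣ union ∣ (iH H union) (suc d C 2) (∣ W ∣ C 2) ((suc d ∸ ∣ W ∣) C 2)
                      hingeSum₁ hingeSum₂ _ k≤d
                      (∑-iH-≤-hinges H) (∑-tight 1≤deg) (union-slack 2≤deg) (C2-split k≤d))
  where
  open AtHinge Xs W
  open InCriticalCover 1≤d sparse cover W large

  1≤deg : 1 ≤ deg Xs W
  1≤deg = ≤-trans (n≤1+n 1) 2≤deg

  k≤d : ∣ W ∣ ≤ d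
  k≤d = ≤-trans k≤d∸1 (m∸n≤m d 1)
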